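{- Let \(m\ge 2\), \(Q_6=(\mathbb Z_m)^6\), and \(\Sigma_6=\{0,\Delta,2,3,4,5,6\}\), where \(\Delta\) is a formal symbol. For \(0\le r\le6\) let \(p_r\in Q_6\) have its first \(r\) coordinates equal to \(1\) and the rest equal to \(0\). For \(\tau\in\mathbb Z_m\) and \(z=(z_1,\ldots,z_6)\in Q_6\), let \(\rho_\tau(z)=\min\{i:z_i=\tau\}\) if such \(i\) exists, and \(\rho_\tau(z)=6\) otherwise. Define \(M_\tau^0(z)=z\), \(M_\tau^\Delta(z)=z-p_{\rho_\tau(z)}\), and for \(2\le a\le6\), \(M_\tau^a(z)=z-p_a\) if \(\rho_\tau(z)<a\) and \(M_\tau^a(z)=z-p_{a-1}\) if \(\rho_\tau(z)\ge a\). Let \(W=(\xi_0,\ldots,\xi_{m-1})\) be a word of length \(m\) over \(\Sigma_6\), let \(N_0,N_\Delta,N_2,\ldots,N_6\) be the numbers of occurrences of the respective symbols in \(W\), and suppose \[ \gcd(N_0,m)=1\quad\text{and}\quad \gcd(N_k-N_\Delta,m)=1\ \ (2\le k\le 6). \] Then for every choice of thresholds \(\tau_0,\ldots,\tau_{m-1}\in\mathbb Z_m\), the map \[ R_W=M_{\tau_{m-1}}^{\xi_{m-1}}\circ\cdots\circ M_{\tau_1}^{\xi_1}\circ M_{\tau_0}^{\xi_0} \] is a single cycle of length \(m^6\) on \(Q_6\).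
   Context: \(\gcd\) of an integer (possibly negative) with \(m\) is the usual nonnegative gcd; the condition means the integer is a unit modulo \(m\). -}

module Defs where

open import Data.Nat using (ℕ; zero; suc; _<_; _<?_)
open import Data.Fin using (Fin; zero; suc; fromℕ; inject₁)
import Data.Fin as Fin
open import Data.Vec using (Vec; []; _∷_)
open import Data.Maybe using (Maybe; just; nothing; maybe′)
open import Data.Product using (_×_; ∃)
open import Relation.Nullary using (¬_; yes; no)
open import Relation.Binary.PropositionalEquality using (_≡_)
open import Function using (_∘_; id)

Q₆ : ℕ → Set
Q₆ m = Vec (Fin m) 6

data Σ₆ : Set where
  s0 sΔ s2 s3 s4 s5 s6 : Σ₆

dec : ∀ {m} → Fin m → Fin m
dec {suc n} zero = fromℕ n
dec {suc n} (suc i) = inject₁ i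

subP : ∀ {m n} → ℕ → Vec (Fin m) n → Vec (Fin m) n
subP zero v = v
subP (suc r) [] = []
subP (suc r) (x ∷ v) = dec x ∷ subP r v

-- 1-based index of the first coordinate equal to τ, if any
firstIdx : ∀ {m n} → Fin m → Vec (Fin m) n → Maybe ℕ
firstIdx τ [] = nothing
firstIdx τ (x ∷ v) with x Fin.≟ τ
... | yes _ = just 1
... | no _ = maybe′ (λ i → just (suc i)) nothing (firstIdx τ v)

ρ : ∀ {m} → Fin m → Q₆ m → ℕ
ρ τ z = maybe′ id 6 (firstIdx τ z)

Ma : ∀ {m} → ℕ → Fin m → Q₆ m → Q₆ m
Ma a τ z with ρ τ z <? a
... | yes _ = subP a z
... | no _ = subP (Data.Nat.pred a) z

M : ∀ {m} → Σ₆ → Fin m → Q₆ m → Q₆ m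
M s0 τ z = z
M sΔ τ z = subP (ρ τ z) z
M s2 τ z = Ma 2 τ z
M s3 τ z = Ma 3 τ z
M s4 τ z = Ma 4 τ z
M s5 τ z = Ma 5 τ z
M s6 τ z = Ma 6 τ z

R : ∀ {m k} → Vec Σ₆ k → Vec (Fin m) k → Q₆ m → Q₆ m
R [] [] = id
R (ξ ∷ W) (τ ∷ τs) = R W τs ∘ M ξ τ

_==_ : Σ₆ → Σ₆ → Data.Nat.ℕ
s0 == s0 = 1
sΔ == sΔ = 1
s2 == s2 = 1
s3 == s3 = 1
s4 == s4 = 1
s5 == s5 = 1
s6 == s6 = 1
_ == _ = 0

count : ∀ {k} → Σ₆ → Vec Σ₆ k → ℕ
count s [] = 0
count s (ξ ∷ W) = (s == ξ) Data.Nat.+ count s W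

iter : ∀ {A : Set} → (A → A) → ℕ → A → A
iter f zero x = x
iter f (suc k) x = f (iter f k x)

IsSingleCycle : ∀ {A : Set} → (A → A) → ℕ → Set
IsSingleCycle {A} f N =
  (∀ x → iter f N x ≡ x) ×
  (∀ x k → 0 < k → k < N → ¬ (iter f k x ≡ x)) ×
  (∀ x y → ∃ λ k → k < N × iter f k x ≡ y)

-- Coordinate i of M^ξ_τ z is z_i or z_i − 1, and which one depends only on ξ, on i and on whether
-- τ occurs among z_1, …, z_(i−1), i.e. whether ρ_τ(z) < i. So on the first j+1 coordinates,
-- Q_(j+1) = ℤ_m × Q_j, the map R_W is a skew product (t, y) ↦ (t − h(y), R_W y) over its action
-- on Q_j, where h(y) is the number of letters of W that decrement coordinate j+1 along the way.
-- Over a single cycle of length L such a skew product is a single cycle of length mL as soon as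
-- the sum of h along the base orbit is a unit mod m. That orbit is all of Q_j, and each M^ξ_τ is
-- a bijection of Q_j, so the sum is Σ_ξ #{y ∈ Q_j : ξ decrements coordinate j+1 at y}: this is
-- m − N_0 for j = 0, and for j ≥ 1 it is N_Δ (m−1)^j + N_(j+1) (m^j − (m−1)^j) plus a multiple
-- of m^j, which is ≡ (N_Δ − N_(j+1)) (m−1)^j mod m.

module Submission where

open import Defs
open import Data.Nat using (ℕ; _≤_; _^_)
open import Data.Fin using (Fin)
open import Data.Vec using (Vec)
open import Data.Integer using (+_; _⊖_)
open import Data.Integer.GCD using (gcd)
open import Relation.Binary.PropositionalEquality using (_≡_)

open import Data.Bool using (Bool; true; false; _∨_; not; if_then_else_)
open import Data.Bool.Properties using (∨-zeroʳ; ∨-identityʳ)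
open import Data.Fin using (zero; suc; toℕ; fromℕ)
import Data.Fin as Fin
open import Data.Fin.Properties using (toℕ-injective; toℕ-inject₁; toℕ-fromℕ; toℕ≤pred[n])
open import Data.Integer using (∣_∣) renaming (_+_ to _+ℤ_; _*_ to _*ℤ_; _-_ to _-ℤ_)
open import Data.Integer.Divisibility.Signed using (∣ᵤ⇒∣; ∣⇒∣ᵤ; ∣m∣n⇒∣m-n)
  renaming (_∣_ to _∣ℤ_)
open import Data.Integer.Properties using (pos-+; pos-*; m-n≡m⊖n; abs-*)
import Data.Integer.Solver as ℤ-Solver
open import Data.List using (List; []; _∷_; map; tabulate; allFin; applyUpTo; cartesianProductWith; _++_; [_])
open import Data.List.Membership.Propositional using (_∈_)
open import Data.List.Membership.Propositional.Properties
  using (∈-map⁺; ∈-applyUpTo⁺; ∈-cartesianProductWith⁺; ∈-allFin)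
open import Data.List.Membership.Propositional.Properties.WithK using (unique∧set⇒bag)
open import Data.List.Properties using (applyUpTo-∷ʳ; map-++; map-∘; map-cong; map-tabulate; tabulate-cong)
open import Data.List.Relation.Binary.BagAndSetEquality using (∼bag⇒↭)
import Data.List.Relation.Binary.Permutation.Propositional.Properties as Perm
import Data.List.Relation.Unary.All as All
import Data.List.Relation.Unary.AllPairs as AllPairs
open import Data.List.Relation.Unary.Any using (here)
open import Data.List.Relation.Unary.Unique.Propositional using (Unique)
import Data.List.Relation.Unary.Unique.Propositional.Properties as Unique
open import Data.Nat
open import Data.Nat.Coprimality using (Coprime; coprime-Bézout; coprime-divisor; gcd≡1⇒coprime)
import Data.Nat.Coprimality as Coprimality
open import Data.Nat.Divisibility
  using (_∣_; divides; ∣⇒≤; ∣-trans; ∣1⇒≡1; ∣m+n∣m⇒∣n; ∣n⇒∣m*n; ∣m⇒∣m*n; m%n≡0⇒n∣m)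
open import Data.Nat.DivMod using (_%_; _/_; m≡m%n+[m/n]*n; m%n<n; [m+kn]%n≡m%n; %-distribˡ-*)
import Data.Nat.GCD as GCD
open import Data.Nat.ListAction using (sum)
open import Data.Nat.ListAction.Properties using (sum-↭; sum-++)
open import Data.Nat.Properties
open import Data.Nat.Solver using (module +-*-Solver)
open import Data.Product using (_×_; _,_; ∃; proj₁; proj₂)
open import Data.Vec using ([]; _∷_)
open import Data.Vec.Properties using (∷-injective)
open import Function using (_∘_; id)
open import Function.Bundles using (mk⇔)
open import Relation.Binary.Definitions using (tri<; tri≈; tri>)
open import Relation.Binary.PropositionalEquality hiding ([_])
open import Relation.Nullary using (yes; no; does; contradiction)
open import Relation.Nullary.Decidable using (dec-true; dec-false)

iter-+ : ∀ {A : Set} (f : A → A) a b x → iter f (a + b) x ≡ iter f a (iter f b x)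
iter-+ f zero    b x = refl
iter-+ f (suc a) b x = cong f (iter-+ f a b x)

iter-*-fixed : ∀ {A : Set} (f : A → A) {L x} → iter f L x ≡ x → ∀ q → iter f (q * L) x ≡ x
iter-*-fixed f         fix zero    = refl
iter-*-fixed f {L} {x} fix (suc q) =
  trans (iter-+ f L (q * L) x) (trans (cong (iter f L) (iter-*-fixed f fix q)) fix)

iter-commute : ∀ {A B : Set} {f : A → A} {g : B → B} (φ : A → B) →
               (∀ x → φ (f x) ≡ g (φ x)) → ∀ k x → φ (iter f k x) ≡ iter g k (φ x)
iter-commute         φ comm zero    x = refl
iter-commute {g = g} φ comm (suc k) x = trans (comm _) (cong g (iter-commute φ comm k x))

iter-∸ : ∀ {A : Set} (f : A → A) {i j} → i ≤ j → ∀ x → iter f (j ∸ i) (iter f i x) ≡ iter f j x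
iter-∸ f {i} {j} i≤j x = trans (sym (iter-+ f (j ∸ i) i x)) (cong (λ k → iter f k x) (m∸n+n≡m i≤j))

iter-%-period : ∀ {A : Set} (f : A → A) {N} .{{_ : NonZero N}} → (∀ x → iter f N x ≡ x) →
                ∀ k x → iter f k x ≡ iter f (k % N) x
iter-%-period f {N} period k x =
  trans (cong (λ i → iter f i x) (m≡m%n+[m/n]*n k N))
        (trans (iter-+ f (k % N) (k / N * N) x) (cong (iter f (k % N)) (iter-*-fixed f (period x) (k / N))))

coprime⇒%-inverse : ∀ {c} m .{{_ : NonZero m}} → Coprime c m → ∃ λ u → (u * c) % m ≡ 1 % m
coprime⇒%-inverse {c} (suc n) cop with coprime-Bézout cop
... | GCD.Bézout.+- x y eq = x , (begin
  (x * c) % suc n          ≡⟨ cong (_% suc n) eq ⟨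
  (1 + y * suc n) % suc n  ≡⟨ [m+kn]%n≡m%n 1 y (suc n) ⟩
  1 % suc n                ∎)
  where open ≡-Reasoning
... | GCD.Bézout.-+ x y eq = x * n , (begin  -- x c ≡ −1, hence x n c ≡ 1 (mod n + 1)
  (x * n * c) % suc n                ≡⟨ [m+kn]%n≡m%n (x * n * c) 1 (suc n) ⟨
  (x * n * c + 1 * suc n) % suc n    ≡⟨ cong (_% suc n) shifted ⟩
  (1 + y * n * suc n) % suc n        ≡⟨ [m+kn]%n≡m%n 1 (y * n) (suc n) ⟩
  1 % suc n                          ∎)
  where
  open ≡-Reasoning
  open +-*-Solver
  shifted : x * n * c + 1 * suc n ≡ 1 + y * n * suc n
  shifted = begin
    x * n * c + 1 * suc n
      ≡⟨ solve 3 (λ x n c → x :* n :* c :+ con 1 :* (con 1 :+ n) := con 1 :+ n :* (con 1 :+ x :* c)) refl x n c ⟩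
    1 + n * (1 + x * c)
      ≡⟨ cong (λ k → 1 + n * k) eq ⟩
    1 + n * (y * suc n)
      ≡⟨ solve 3 (λ n y m → con 1 :+ n :* (y :* m) := con 1 :+ y :* n :* m) refl n y (suc n) ⟩
    1 + y * n * suc n       ∎

IsSingleCycle-reflect : ∀ {A B : Set} {f : A → A} {g : B → B} {N} (φ : A → B) →
                        (∀ {x y} → φ x ≡ φ y → x ≡ y) → (∀ x → φ (f x) ≡ g (φ x)) →
                        IsSingleCycle g N → IsSingleCycle f N
IsSingleCycle-reflect {f = f} {N = N} φ φ-inj comm (period , aperiodic , reach) =
  (λ x → φ-inj (trans (φ-iter N x) (period (φ x)))) ,
  (λ x k 0<k k<N fix → aperiodic (φ x) k 0<k k<N (trans (sym (φ-iter k x)) (cong φ fix))) ,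
  λ x y → let k , k<N , k-reaches = reach (φ x) (φ y) in k , k<N , φ-inj (trans (φ-iter k x) k-reaches)
  where
  φ-iter : ∀ k x → φ (iter f k x) ≡ iter _ k (φ x)
  φ-iter = iter-commute φ comm

Vec0-isSingleCycle : ∀ {A : Set} (f : Vec A 0 → Vec A 0) → IsSingleCycle f 1
Vec0-isSingleCycle f =
  (λ x → Vec0-unique _ x) ,
  (λ _ k 0<k k<1 _ → <⇒≱ 0<k (≤-pred k<1)) ,
  λ x y → 0 , s≤s z≤n , Vec0-unique x y
  where
  Vec0-unique : ∀ {A : Set} (u v : Vec A 0) → u ≡ v
  Vec0-unique [] [] = refl

module _ {A : Set} {f : A → A} {L : ℕ} (x₀ : A) (closed : iter f L x₀ ≡ x₀)
         (distinct : ∀ {a b} → a < b → b < L → iter f a x₀ ≢ iter f b x₀)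
         (covers : ∀ y → ∃ λ k → k < L × iter f k x₀ ≡ y) where

  private
    iter-+L : ∀ k → iter f (k + L) x₀ ≡ iter f k x₀
    iter-+L k = trans (iter-+ f k L x₀) (cong (iter f k) closed)

    orbit-period : ∀ x → iter f L x ≡ x
    orbit-period x with covers x
    ... | a , _ , refl = begin
      iter f L (iter f a x₀)  ≡⟨ iter-+ f L a x₀ ⟨
      iter f (L + a) x₀       ≡⟨ cong (λ k → iter f k x₀) (+-comm L a) ⟩
      iter f (a + L) x₀       ≡⟨ iter-+L a ⟩
      iter f a x₀             ∎
      where open ≡-Reasoning

    orbit-aperiodic : ∀ x k → 0 < k → k < L → iter f k x ≢ x
    orbit-aperiodic x k 0<k k<L fix with covers x
    ... | a , a<L , refl with k + a <? L
    ...   | yes k+a<L = distinct (m<n+m a 0<k) k+a<L (sym (trans (iter-+ f k a x₀) fix))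
    ...   | no  k+a≮L = distinct r<a a<L (begin
      iter f r x₀             ≡⟨ iter-+L r ⟨
      iter f (r + L) x₀       ≡⟨ cong (λ i → iter f i x₀) (m∸n+n≡m L≤k+a) ⟩
      iter f (k + a) x₀       ≡⟨ iter-+ f k a x₀ ⟩
      iter f k (iter f a x₀)  ≡⟨ fix ⟩
      iter f a x₀             ∎)
      where
      open ≡-Reasoning
      L≤k+a = ≮⇒≥ k+a≮L
      r = k + a ∸ L
      r<a : r < a
      r<a = +-cancelʳ-< L r a (subst₂ _<_ (sym (m∸n+n≡m L≤k+a)) (+-comm L a) (+-monoˡ-< a k<L))

    orbit-reach : ∀ x y → ∃ λ k → k < L × iter f k x ≡ y
    orbit-reach x y with covers x | covers y
    ... | a , a<L , refl | b , b<L , refl with a ≤? b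
    ...   | yes a≤b = b ∸ a , ≤-<-trans (m∸n≤m b a) b<L , iter-∸ f a≤b x₀
    ...   | no  a≰b = L ∸ a + b , bound , (begin
      iter f (L ∸ a + b) (iter f a x₀)  ≡⟨ iter-+ f (L ∸ a + b) a x₀ ⟨
      iter f (L ∸ a + b + a) x₀         ≡⟨ cong (λ k → iter f k x₀) wraps ⟩
      iter f (b + L) x₀                 ≡⟨ iter-+L b ⟩
      iter f b x₀                       ∎)
      where
      open ≡-Reasoning
      wraps : L ∸ a + b + a ≡ b + L
      wraps = trans (+-assoc (L ∸ a) b a) (trans (cong (_+_ (L ∸ a)) (+-comm b a))
                (trans (sym (+-assoc (L ∸ a) a b)) (trans (cong (_+ b) (m∸n+n≡m (<⇒≤ a<L))) (+-comm L b))))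
      bound : L ∸ a + b < L
      bound = subst (L ∸ a + b <_) (m∸n+n≡m (<⇒≤ a<L)) (+-monoʳ-< (L ∸ a) (≰⇒> a≰b))

  IsSingleCycle-fromOrbit : IsSingleCycle f L
  IsSingleCycle-fromOrbit = orbit-period , orbit-aperiodic , orbit-reach

module SingleCycle {A : Set} {f : A → A} {L : ℕ} (cyc : IsSingleCycle f L) where

  iter-period : ∀ x → iter f L x ≡ x
  iter-period = proj₁ cyc

  aperiodic : ∀ x k → 0 < k → k < L → iter f k x ≢ x
  aperiodic = proj₁ (proj₂ cyc)

  reach : ∀ x y → ∃ λ k → k < L × iter f k x ≡ y
  reach = proj₂ (proj₂ cyc)

  length-nonZero : A → NonZero L
  length-nonZero x = >-nonZero (≤-<-trans z≤n (proj₁ (proj₂ (reach x x))))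

  iter-% : .{{_ : NonZero L}} → ∀ k x → iter f k x ≡ iter f (k % L) x
  iter-% = iter-%-period f iter-period

  period-∣ : ∀ k x → iter f k x ≡ x → L ∣ k
  period-∣ k x fix = m%n≡0⇒n∣m k L (remainder≡0 (k % L) refl)
    where
    instance
      L≢0 : NonZero L
      L≢0 = length-nonZero x
    remainder≡0 : ∀ r → k % L ≡ r → r ≡ 0
    remainder≡0 zero    _      = refl
    remainder≡0 (suc r) k%L≡r = contradiction (trans (sym (iter-% k x)) fix)
      (aperiodic x (k % L) (subst (0 <_) (sym k%L≡r) z<s) (m%n<n k L))

  orbit-injective : ∀ x {a b} → a < L → b < L → iter f a x ≡ iter f b x → a ≡ b
  orbit-injective x {a} {b} a<L b<L eq with <-cmp a b
  ... | tri< a<b _ _ = contradiction (trans (iter-∸ f (<⇒≤ a<b) x) (sym eq))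
                         (aperiodic _ (b ∸ a) (m<n⇒0<n∸m a<b) (≤-<-trans (m∸n≤m b a) b<L))
  ... | tri≈ _ a≡b _ = a≡b
  ... | tri> _ _ b<a = contradiction (trans (iter-∸ f (<⇒≤ b<a) x) eq)
                         (aperiodic _ (a ∸ b) (m<n⇒0<n∸m b<a) (≤-<-trans (m∸n≤m a b) a<L))

  iter-inverseˡ : ∀ k x → iter f (pred L * k) (iter f k x) ≡ x
  iter-inverseˡ k x = begin
    iter f (pred L * k) (iter f k x)  ≡⟨ iter-+ f (pred L * k) k x ⟨
    iter f (pred L * k + k) x         ≡⟨ cong (λ i → iter f i x) pred[L]*k+k≡k*L ⟩
    iter f (k * L) x                  ≡⟨ iter-*-fixed f (iter-period x) k ⟩
    x                                 ∎
    where
    open ≡-Reasoning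
    instance
      L≢0 : NonZero L
      L≢0 = length-nonZero x
    pred[L]*k+k≡k*L : pred L * k + k ≡ k * L
    pred[L]*k+k≡k*L = trans (+-comm (pred L * k) k) (trans (cong (_* k) (suc-pred L)) (*-comm L k))

  iter-inverseʳ : ∀ k x → iter f k (iter f (pred L * k) x) ≡ x
  iter-inverseʳ k x = begin
    iter f k (iter f (pred L * k) x)  ≡⟨ iter-+ f k (pred L * k) x ⟨
    iter f (k + pred L * k) x         ≡⟨ cong (λ i → iter f i x) (+-comm k (pred L * k)) ⟩
    iter f (pred L * k + k) x         ≡⟨ iter-+ f (pred L * k) k x ⟩
    iter f (pred L * k) (iter f k x)  ≡⟨ iter-inverseˡ k x ⟩
    x                                 ∎
    where open ≡-Reasoning

  coprime-stride-reach : ∀ {c} → Coprime c L → ∀ x y → ∃ λ q → iter f (q * c) x ≡ y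
  coprime-stride-reach {c} cop x y = k * u , (begin
    iter f (k * u * c) x           ≡⟨ iter-% (k * u * c) x ⟩
    iter f ((k * u * c) % L) x     ≡⟨ cong (λ i → iter f i x) k*u*c≡k ⟩
    iter f (k % L) x               ≡⟨ iter-% k x ⟨
    iter f k x                     ≡⟨ k-reaches ⟩
    y                              ∎)
    where
    open ≡-Reasoning
    instance
      L≢0 : NonZero L
      L≢0 = length-nonZero x
    k = proj₁ (reach x y)
    k-reaches = proj₂ (proj₂ (reach x y))
    u = proj₁ (coprime⇒%-inverse L cop)
    u-inverse = proj₂ (coprime⇒%-inverse L cop)
    k*u*c≡k : (k * u * c) % L ≡ k % L
    k*u*c≡k = begin
      (k * u * c) % L                  ≡⟨ cong (_% L) (*-assoc k u c) ⟩
      (k * (u * c)) % L                ≡⟨ %-distribˡ-* k (u * c) L ⟩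
      ((k % L) * ((u * c) % L)) % L    ≡⟨ cong (λ r → ((k % L) * r) % L) u-inverse ⟩
      ((k % L) * (1 % L)) % L          ≡⟨ %-distribˡ-* k 1 L ⟨
      (k * 1) % L                      ≡⟨ cong (_% L) (*-identityʳ k) ⟩
      k % L                            ∎

toℕ-dec : ∀ {n} (u : Fin (suc n)) → 0 < toℕ u → toℕ (dec u) ≡ pred (toℕ u)
toℕ-dec (suc i) _ = toℕ-inject₁ i

toℕ-iter-dec-fromℕ : ∀ {n} k → k ≤ n → toℕ (iter dec k (fromℕ n)) ≡ n ∸ k
toℕ-iter-dec-fromℕ {n} zero    _   = toℕ-fromℕ n
toℕ-iter-dec-fromℕ {n} (suc k) k<n =
  trans (toℕ-dec _ (subst (0 <_) (sym previous) (m<n⇒0<n∸m k<n)))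
        (trans (cong pred previous) (pred[m∸n]≡m∸[1+n] n k))
  where previous = toℕ-iter-dec-fromℕ k (<⇒≤ k<n)

dec-isSingleCycle : ∀ {n} → IsSingleCycle (dec {suc n}) (suc n)
dec-isSingleCycle {n} = IsSingleCycle-fromOrbit (fromℕ n) closed distinct covers
  where
  closed : dec (iter dec n (fromℕ n)) ≡ fromℕ n
  closed = cong dec (toℕ-injective {j = zero} (trans (toℕ-iter-dec-fromℕ n ≤-refl) (n∸n≡0 n)))
  distinct : ∀ {a b} → a < b → b < suc n → iter dec a (fromℕ n) ≢ iter dec b (fromℕ n)
  distinct {a} {b} a<b (s≤s b≤n) eq = <⇒≢ a<b (∸-cancelˡ-≡ (≤-trans (<⇒≤ a<b) b≤n) b≤n (begin
    n ∸ a                         ≡⟨ toℕ-iter-dec-fromℕ a (≤-trans (<⇒≤ a<b) b≤n) ⟨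
    toℕ (iter dec a (fromℕ n))    ≡⟨ cong toℕ eq ⟩
    toℕ (iter dec b (fromℕ n))    ≡⟨ toℕ-iter-dec-fromℕ b b≤n ⟩
    n ∸ b                         ∎))
    where open ≡-Reasoning
  covers : ∀ y → ∃ λ k → k < suc n × iter dec k (fromℕ n) ≡ y
  covers y = n ∸ toℕ y , s≤s (m∸n≤m n (toℕ y)) , toℕ-injective
    (trans (toℕ-iter-dec-fromℕ (n ∸ toℕ y) (m∸n≤m n (toℕ y))) (m∸[m∸n]≡n (toℕ≤pred[n] y)))

Enumerates : ∀ {B : Set} → List B → Set
Enumerates xs = Unique xs × (∀ x → x ∈ xs)

sum-map-enumerations : ∀ {B : Set} {xs ys : List B} → Enumerates xs → Enumerates ys →
                       ∀ h → sum (map h xs) ≡ sum (map h ys)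
sum-map-enumerations (xs-unique , xs-complete) (ys-unique , ys-complete) h =
  sum-↭ (Perm.map⁺ h (∼bag⇒↭ (unique∧set⇒bag xs-unique ys-unique
                                 (mk⇔ (λ _ → ys-complete _) (λ _ → xs-complete _)))))

map-enumerates : ∀ {B : Set} {xs : List B} (φ : B → B) → (∀ {x y} → φ x ≡ φ y → x ≡ y) →
                 (∀ y → ∃ λ x → φ x ≡ y) → Enumerates xs → Enumerates (map φ xs)
map-enumerates φ φ-inj φ-surj (unique , complete) = Unique.map⁺ φ-inj unique , covered
  where
  covered : ∀ y → y ∈ map φ _
  covered y with φ-surj y
  ... | x , refl = ∈-map⁺ φ (complete x)

sum-map-+ : ∀ {A : Set} (f g : A → ℕ) xs →
            sum (map (λ x → f x + g x) xs) ≡ sum (map f xs) + sum (map g xs)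
sum-map-+ f g []       = refl
sum-map-+ f g (x ∷ xs) = trans (cong (_+_ (f x + g x)) (sum-map-+ f g xs))
  (solve 4 (λ a b c d → a :+ b :+ (c :+ d) := a :+ c :+ (b :+ d)) refl (f x) (g x) (sum (map f xs)) (sum (map g xs)))
  where open +-*-Solver

sum-map-0 : ∀ {A : Set} (xs : List A) → sum (map (λ _ → 0) xs) ≡ 0
sum-map-0 []       = refl
sum-map-0 (_ ∷ xs) = sum-map-0 xs

sum-cartesianProductWith : ∀ {A B C : Set} (_∙_ : A → B → C) (h : C → ℕ) xs ys →
  sum (map h (cartesianProductWith _∙_ xs ys)) ≡ sum (map (λ x → sum (map (λ y → h (x ∙ y)) ys)) xs)
sum-cartesianProductWith _∙_ h []       ys = refl
sum-cartesianProductWith _∙_ h (x ∷ xs) ys = begin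
  sum (map h (map (x ∙_) ys ++ cartesianProductWith _∙_ xs ys))
    ≡⟨ cong sum (map-++ h (map (x ∙_) ys) _) ⟩
  sum (map h (map (x ∙_) ys) ++ map h (cartesianProductWith _∙_ xs ys))
    ≡⟨ sum-++ (map h (map (x ∙_) ys)) _ ⟩
  sum (map h (map (x ∙_) ys)) + sum (map h (cartesianProductWith _∙_ xs ys))
    ≡⟨ cong₂ _+_ (cong sum (sym (map-∘ ys))) (sum-cartesianProductWith _∙_ h xs ys) ⟩
  sum (map (λ y → h (x ∙ y)) ys) + sum (map (λ x → sum (map (λ y → h (x ∙ y)) ys)) xs) ∎
  where open ≡-Reasoning

sum-tabulate-const : ∀ k c → sum (tabulate {n = k} (λ _ → c)) ≡ k * c
sum-tabulate-const zero    c = refl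
sum-tabulate-const (suc k) c = cong (_+_ c) (sum-tabulate-const k c)

sum-tabulate-except : ∀ k (τ : Fin (suc k)) c →
                      sum (tabulate (λ x → if does (x Fin.≟ τ) then 0 else c)) ≡ k * c
sum-tabulate-except k       zero    c = sum-tabulate-const k c
sum-tabulate-except (suc k) (suc τ) c = cong (_+_ c) (sum-tabulate-except k τ c)

module SkewProduct {A B : Set} {g : A → A} {m : ℕ} (g-cycle : IsSingleCycle g m)
                   {S : B → B} {L : ℕ} (S-cycle : IsSingleCycle S L) (h : B → ℕ) where

  open SingleCycle

  skew : A × B → A × B
  skew (t , y) = iter g (h y) t , S y

  cocycle : ℕ → B → ℕ
  cocycle zero    y = 0
  cocycle (suc k) y = h (iter S k y) + cocycle k y

  iter-skew : ∀ k t y → iter skew k (t , y) ≡ (iter g (cocycle k y) t , iter S k y)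
  iter-skew zero    t y = refl
  iter-skew (suc k) t y =
    trans (cong skew (iter-skew k t y)) (cong (_, _) (sym (iter-+ g (h (iter S k y)) (cocycle k y) t)))

  iter-skew-* : ∀ q t y → iter skew (q * L) (t , y) ≡ (iter g (q * cocycle L y) t , y)
  iter-skew-* zero    t y = refl
  iter-skew-* (suc q) t y = begin
    iter skew (L + q * L) (t , y)                   ≡⟨ iter-+ skew L (q * L) (t , y) ⟩
    iter skew L (iter skew (q * L) (t , y))         ≡⟨ cong (iter skew L) (iter-skew-* q t y) ⟩
    iter skew L (iter g (q * cocycle L y) t , y)    ≡⟨ iter-skew L _ y ⟩
    (iter g (cocycle L y) (iter g (q * cocycle L y) t) , iter S L y)
      ≡⟨ cong₂ _,_ (sym (iter-+ g (cocycle L y) (q * cocycle L y) t)) (iter-period S-cycle y) ⟩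
    (iter g (cocycle L y + q * cocycle L y) t , y)  ∎
    where open ≡-Reasoning

  cocycle≡sum-orbit : ∀ k y → cocycle k y ≡ sum (map h (applyUpTo (λ i → iter S i y) k))
  cocycle≡sum-orbit zero    y = refl
  cocycle≡sum-orbit (suc k) y = begin
    h (iter S k y) + cocycle k y                ≡⟨ +-comm _ (cocycle k y) ⟩
    cocycle k y + h (iter S k y)                ≡⟨ cong₂ _+_ (cocycle≡sum-orbit k y) (sym (+-identityʳ _)) ⟩
    sum (map h orbit) + sum [ h (iter S k y) ]  ≡⟨ sum-++ (map h orbit) _ ⟨
    sum (map h orbit ++ [ h (iter S k y) ])     ≡⟨ cong sum (map-++ h orbit _) ⟨
    sum (map h (orbit ++ [ iter S k y ]))       ≡⟨ cong (sum ∘ map h) (applyUpTo-∷ʳ (λ i → iter S i y) k) ⟩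
    sum (map h (applyUpTo (λ i → iter S i y) (suc k))) ∎
    where
    open ≡-Reasoning
    orbit = applyUpTo (λ i → iter S i y) k

  orbit-enumerates : ∀ y → Enumerates (applyUpTo (λ i → iter S i y) L)
  orbit-enumerates y =
    Unique.applyUpTo⁺₁ _ L (λ i<j j<L → <⇒≢ i<j ∘ orbit-injective S-cycle y (<-trans i<j j<L) j<L) ,
    λ z → let k , k<L , k-reaches = reach S-cycle y z in subst (_∈ _) k-reaches (∈-applyUpTo⁺ _ k<L)

  cocycle-period≡sum : ∀ {xs} → Enumerates xs → ∀ y → cocycle L y ≡ sum (map h xs)
  cocycle-period≡sum enum y = trans (cocycle≡sum-orbit L y) (sum-map-enumerations (orbit-enumerates y) enum h)

  skew-period : ∀ x → iter skew (m * L) x ≡ x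
  skew-period (t , y) = trans (iter-skew-* m t y) (cong (_, y) (begin
    iter g (m * cocycle L y) t  ≡⟨ cong (λ k → iter g k t) (*-comm m (cocycle L y)) ⟩
    iter g (cocycle L y * m) t  ≡⟨ iter-*-fixed g (iter-period g-cycle t) (cocycle L y) ⟩
    t                           ∎))
    where open ≡-Reasoning

  module _ (coprime : ∀ y → Coprime (cocycle L y) m) where

    skew-aperiodic : ∀ x k → 0 < k → k < m * L → iter skew k x ≢ x
    skew-aperiodic (t , y) k 0<k k<mL fix
      with period-∣ S-cycle k y (cong proj₂ (trans (sym (iter-skew k t y)) fix))
    ... | divides q refl = <⇒≱ q<m (∣⇒≤ {{>-nonZero 0<q}} m∣q)
      where
      0<q : 0 < q
      0<q = n≢0⇒n>0 λ { refl → <-irrefl refl 0<k }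
      q<m : q < m
      q<m = *-cancelʳ-< L q m k<mL
      m∣q : m ∣ q
      m∣q = coprime-divisor (Coprimality.sym (coprime y))
              (subst (m ∣_) (*-comm q (cocycle L y))
                (period-∣ g-cycle _ t (cong proj₁ (trans (sym (iter-skew-* q t y)) fix))))

    skew-reach : ∀ x x′ → ∃ λ k → k < m * L × iter skew k x ≡ x′
    skew-reach (t , y) (t′ , y′) =
      k % (m * L) , m%n<n k (m * L) , trans (sym (iter-%-period skew skew-period k (t , y))) lands
      where
      instance
        mL≢0 : NonZero (m * L)
        mL≢0 = m*n≢0 m L {{length-nonZero g-cycle t}} {{length-nonZero S-cycle y}}
      r = proj₁ (reach S-cycle y y′)
      r-reaches = proj₂ (proj₂ (reach S-cycle y y′))
      t₁ = iter g (cocycle r y) t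
      q = proj₁ (coprime-stride-reach g-cycle (coprime y′) t₁ t′)
      q-reaches = proj₂ (coprime-stride-reach g-cycle (coprime y′) t₁ t′)
      k = q * L + r
      lands : iter skew k (t , y) ≡ (t′ , y′)
      lands = begin
        iter skew (q * L + r) (t , y)               ≡⟨ iter-+ skew (q * L) r (t , y) ⟩
        iter skew (q * L) (iter skew r (t , y))     ≡⟨ cong (iter skew (q * L)) (iter-skew r t y) ⟩
        iter skew (q * L) (t₁ , iter S r y)         ≡⟨ cong (λ z → iter skew (q * L) (t₁ , z)) r-reaches ⟩
        iter skew (q * L) (t₁ , y′)                 ≡⟨ iter-skew-* q t₁ y′ ⟩
        (iter g (q * cocycle L y′) t₁ , y′)         ≡⟨ cong (_, y′) q-reaches ⟩
        (t′ , y′)                                   ∎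
        where open ≡-Reasoning

    skew-isSingleCycle : IsSingleCycle skew (m * L)
    skew-isSingleCycle = skew-period , skew-aperiodic , skew-reach

data Effect : Set where
  untouched decremented ifSeen ifUnseen : Effect

indicator : Bool → ℕ
indicator true  = 1
indicator false = 0

amount : Effect → Bool → ℕ
amount untouched   _    = 0
amount decremented _    = 1
amount ifSeen      seen = indicator seen
amount ifUnseen    seen = indicator (not seen)

effectAt : ℕ → ℕ → Effect
effectAt a i with compare i a
... | less    _ _ = decremented
... | equal   _   = ifSeen
... | greater _ _ = untouched

effect : Σ₆ → ℕ → Effect
effect s0 _ = untouched
effect sΔ _ = ifUnseen
effect s2   = effectAt 2
effect s3   = effectAt 3
effect s4   = effectAt 4
effect s5   = effectAt 5
effect s6   = effectAt 6

-- Points are written backwards, (z_j, …, z_1): the head is the coordinate acted on, the tail all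
-- it depends on. The disjunction is nested like ρ, so that seen-prefixes holds by computation.
seen : ∀ {m j} → Fin m → Vec (Fin m) j → Bool
seen τ []      = false
seen τ (x ∷ y) = seen τ y ∨ does (x Fin.≟ τ)

decrement : ∀ {m j} → Σ₆ → Fin m → Vec (Fin m) j → ℕ
decrement {j = j} ξ τ y = amount (effect ξ (suc j)) (seen τ y)

Mʳ : ∀ {m j} → Σ₆ → Fin m → Vec (Fin m) j → Vec (Fin m) j
Mʳ ξ τ []      = []
Mʳ ξ τ (t ∷ y) = iter dec (decrement ξ τ y) t ∷ Mʳ ξ τ y

Rʳ : ∀ {m k j} → Vec Σ₆ k → Vec (Fin m) k → Vec (Fin m) j → Vec (Fin m) j
Rʳ []      []       = id
Rʳ (ξ ∷ W) (τ ∷ τs) = Rʳ W τs ∘ Mʳ ξ τ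

weight : ∀ {m k j} → Vec Σ₆ k → Vec (Fin m) k → Vec (Fin m) j → ℕ
weight []      []       y = 0
weight (ξ ∷ W) (τ ∷ τs) y = weight W τs (Mʳ ξ τ y) + decrement ξ τ y

Rʳ-∷ : ∀ {m k j} (W : Vec Σ₆ k) (τs : Vec (Fin m) k) t (y : Vec (Fin m) j) →
        Rʳ W τs (t ∷ y) ≡ iter dec (weight W τs y) t ∷ Rʳ W τs y
Rʳ-∷ []      []       t y = refl
Rʳ-∷ (ξ ∷ W) (τ ∷ τs) t y =
  trans (Rʳ-∷ W τs _ (Mʳ ξ τ y))
        (cong (_∷ Rʳ W τs (Mʳ ξ τ y)) (sym (iter-+ dec (weight W τs (Mʳ ξ τ y)) _ t)))

thresholdAt : ℕ → ℕ → ℕ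
thresholdAt a r with r <? a
... | yes _ = a
... | no  _ = pred a

threshold : Σ₆ → ℕ → ℕ
threshold s0 _ = 0
threshold sΔ r = r
threshold s2   = thresholdAt 2
threshold s3   = thresholdAt 3
threshold s4   = thresholdAt 4
threshold s5   = thresholdAt 5
threshold s6   = thresholdAt 6

Ma≡subP-thresholdAt : ∀ {m} a (τ : Fin m) z → Ma a τ z ≡ subP (thresholdAt a (ρ τ z)) z
Ma≡subP-thresholdAt a τ z with ρ τ z <? a
... | yes _ = refl
... | no  _ = refl

M≡subP-threshold : ∀ {m} ξ (τ : Fin m) z → M ξ τ z ≡ subP (threshold ξ (ρ τ z)) z
M≡subP-threshold s0 τ z = refl
M≡subP-threshold sΔ τ z = refl
M≡subP-threshold s2 τ z = Ma≡subP-thresholdAt 2 τ z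
M≡subP-threshold s3 τ z = Ma≡subP-thresholdAt 3 τ z
M≡subP-threshold s4 τ z = Ma≡subP-thresholdAt 4 τ z
M≡subP-threshold s5 τ z = Ma≡subP-thresholdAt 5 τ z
M≡subP-threshold s6 τ z = Ma≡subP-thresholdAt 6 τ z

≤ᵇ-true : ∀ {m n} → m ≤ n → (m ≤ᵇ n) ≡ true
≤ᵇ-true {m} {n} = dec-true (m ≤? n)

≤ᵇ-false : ∀ {m n} → n < m → (m ≤ᵇ n) ≡ false
≤ᵇ-false {m} {n} n<m = dec-false (m ≤? n) (<⇒≱ n<m)

amount-thresholdAt : ∀ a i r →
                     amount (effectAt a (suc i)) (r <ᵇ suc i) ≡ indicator (suc i ≤ᵇ thresholdAt a r)
amount-thresholdAt a i r with compare (suc i) a | r <? a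
... | less    _ k | yes _   = sym (cong indicator (≤ᵇ-true (m≤n⇒m≤1+n (m≤m+n (suc i) k))))
... | less    _ k | no  _   = sym (cong indicator (≤ᵇ-true (m≤m+n (suc i) k)))
... | equal   _   | yes r<a =
  trans (cong indicator (≤ᵇ-true r<a)) (sym (cong indicator (≤ᵇ-true (≤-refl {suc i}))))
... | equal   _   | no  r≮a =
  trans (cong indicator (≤ᵇ-false (s≤s (≮⇒≥ r≮a)))) (sym (cong indicator (≤ᵇ-false (≤-refl {suc i}))))
... | greater a k | yes _   = sym (cong indicator (≤ᵇ-false (s≤s (m≤m+n a k))))
... | greater a k | no  _   = sym (cong indicator (≤ᵇ-false (s≤s (≤-trans pred[n]≤n (m≤m+n a k)))))

not-<ᵇ : ∀ r i → not (r <ᵇ suc i) ≡ (suc i ≤ᵇ r)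
not-<ᵇ zero    i       = refl
not-<ᵇ (suc r) zero    = refl
not-<ᵇ (suc r) (suc i) = not-<ᵇ r i

amount-threshold : ∀ ξ i r →
                   amount (effect ξ (suc i)) (r <ᵇ suc i) ≡ indicator (suc i ≤ᵇ threshold ξ r)
amount-threshold s0 i r = refl
amount-threshold sΔ i r = cong indicator (not-<ᵇ r i)
amount-threshold s2 i r = amount-thresholdAt 2 i r
amount-threshold s3 i r = amount-thresholdAt 3 i r
amount-threshold s4 i r = amount-thresholdAt 4 i r
amount-threshold s5 i r = amount-thresholdAt 5 i r
amount-threshold s6 i r = amount-thresholdAt 6 i r

rev6 : ∀ {A : Set} → Vec A 6 → Vec A 6
rev6 (a ∷ b ∷ c ∷ d ∷ e ∷ f ∷ []) = f ∷ e ∷ d ∷ c ∷ b ∷ a ∷ []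

rev6-injective : ∀ {A : Set} {u v : Vec A 6} → rev6 u ≡ rev6 v → u ≡ v
rev6-injective {u = _ ∷ _ ∷ _ ∷ _ ∷ _ ∷ _ ∷ []} {_ ∷ _ ∷ _ ∷ _ ∷ _ ∷ _ ∷ []} refl = refl

rev6-subP : ∀ {m} r (a b c d e f : Fin m) →
            rev6 (subP r (a ∷ b ∷ c ∷ d ∷ e ∷ f ∷ [])) ≡
            iter dec (indicator (6 ≤ᵇ r)) f ∷ iter dec (indicator (5 ≤ᵇ r)) e ∷
            iter dec (indicator (4 ≤ᵇ r)) d ∷ iter dec (indicator (3 ≤ᵇ r)) c ∷
            iter dec (indicator (2 ≤ᵇ r)) b ∷ iter dec (indicator (1 ≤ᵇ r)) a ∷ []
rev6-subP 0 a b c d e f = refl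
rev6-subP 1 a b c d e f = refl
rev6-subP 2 a b c d e f = refl
rev6-subP 3 a b c d e f = refl
rev6-subP 4 a b c d e f = refl
rev6-subP 5 a b c d e f = refl
rev6-subP 6 a b c d e f = refl
rev6-subP (suc (suc (suc (suc (suc (suc (suc r))))))) a b c d e f = refl

seen-prefixes : ∀ {m} (τ a b c d e f : Fin m) → let r = ρ τ (a ∷ b ∷ c ∷ d ∷ e ∷ f ∷ []) in
  (seen τ [] ≡ (r <ᵇ 1)) × (seen τ (a ∷ []) ≡ (r <ᵇ 2)) × (seen τ (b ∷ a ∷ []) ≡ (r <ᵇ 3)) ×
  (seen τ (c ∷ b ∷ a ∷ []) ≡ (r <ᵇ 4)) × (seen τ (d ∷ c ∷ b ∷ a ∷ []) ≡ (r <ᵇ 5)) ×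
  (seen τ (e ∷ d ∷ c ∷ b ∷ a ∷ []) ≡ (r <ᵇ 6))
seen-prefixes τ a b c d e f with a Fin.≟ τ
... | yes _ = refl , refl , refl , refl , refl , refl
... | no  _ with b Fin.≟ τ
... | yes _ = refl , refl , refl , refl , refl , refl
... | no  _ with c Fin.≟ τ
... | yes _ = refl , refl , refl , refl , refl , refl
... | no  _ with d Fin.≟ τ
... | yes _ = refl , refl , refl , refl , refl , refl
... | no  _ with e Fin.≟ τ
... | yes _ = refl , refl , refl , refl , refl , refl
... | no  _ with f Fin.≟ τ
... | yes _ = refl , refl , refl , refl , refl , refl
... | no  _ = refl , refl , refl , refl , refl , refl

M-reversed : ∀ {m} ξ (τ : Fin m) z → rev6 (M ξ τ z) ≡ Mʳ ξ τ (rev6 z)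
M-reversed {m} ξ τ z@(a ∷ b ∷ c ∷ d ∷ e ∷ f ∷ []) =
  let s₁ , s₂ , s₃ , s₄ , s₅ , s₆ = seen-prefixes τ a b c d e f in
  trans (cong rev6 (M≡subP-threshold ξ τ z)) (trans (rev6-subP (threshold ξ r) a b c d e f)
    (cong₂ _∷_ (coordinate 5 f s₆) (cong₂ _∷_ (coordinate 4 e s₅) (cong₂ _∷_ (coordinate 3 d s₄)
    (cong₂ _∷_ (coordinate 2 c s₃) (cong₂ _∷_ (coordinate 1 b s₂) (cong₂ _∷_ (coordinate 0 a s₁)
     refl)))))))
  where
  r = ρ τ z
  coordinate : ∀ i {s} (x : Fin m) → s ≡ (r <ᵇ suc i) →
               iter dec (indicator (suc i ≤ᵇ threshold ξ r)) x ≡ iter dec (amount (effect ξ (suc i)) s) x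
  coordinate i x s≡ = cong (λ k → iter dec k x)
    (sym (trans (cong (amount (effect ξ (suc i))) s≡) (amount-threshold ξ i r)))

R-reversed : ∀ {m k} (W : Vec Σ₆ k) (τs : Vec (Fin m) k) z → rev6 (R W τs z) ≡ Rʳ W τs (rev6 z)
R-reversed []      []       z = refl
R-reversed (ξ ∷ W) (τ ∷ τs) z = trans (R-reversed W τs (M ξ τ z)) (cong (Rʳ W τs) (M-reversed ξ τ z))

coprime-* : ∀ {a b m} → Coprime a m → Coprime b m → Coprime (a * b) m
coprime-* {a} {b} {m} a⊥m b⊥m {d} (d∣ab , d∣m) = b⊥m (coprime-divisor d⊥a d∣ab , d∣m)
  where
  d⊥a : Coprime d a
  d⊥a (i∣d , i∣a) = a⊥m (i∣a , ∣-trans i∣d d∣m)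

coprime-^ : ∀ {a m} j → Coprime a m → Coprime (a ^ j) m
coprime-^ zero    a⊥m (d∣1 , _) = ∣1⇒≡1 d∣1
coprime-^ (suc j) a⊥m = coprime-* a⊥m (coprime-^ j a⊥m)

pred-coprime : ∀ n → Coprime n (suc n)
pred-coprime n {d} (d∣n , d∣1+n) = ∣1⇒≡1 (∣m+n∣m⇒∣n (subst (d ∣_) (+-comm 1 n) d∣1+n) d∣n)

coprime-of-combination : ∀ {m A C a b K Q} → Coprime ∣ b ⊖ a ∣ m → Coprime A m →
                         C + b * A ≡ a * A + K * (m * Q) → Coprime C m
coprime-of-combination {m} {A} {C} {a} {b} {K} {Q} [b-a]⊥m A⊥m eq {d} (d∣C , d∣m) =
  [b-a]⊥m (coprime-divisor d⊥A (subst (d ∣_) (abs-* (+ A) (b ⊖ a)) (∣⇒∣ᵤ d∣A[b-a])) , d∣m)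
  where
  open ℤ-Solver.+-*-Solver
  X = K * (m * Q)
  d⊥A : Coprime d A
  d⊥A (i∣d , i∣A) = A⊥m (i∣A , ∣-trans i∣d d∣m)
  eqℤ : + C +ℤ + b *ℤ + A ≡ + a *ℤ + A +ℤ + X
  eqℤ = begin
    + C +ℤ + b *ℤ + A   ≡⟨ cong (+ C +ℤ_) (pos-* b A) ⟨
    + C +ℤ + (b * A)    ≡⟨ pos-+ C (b * A) ⟨
    + (C + b * A)       ≡⟨ cong +_ eq ⟩
    + (a * A + X)       ≡⟨ pos-+ (a * A) X ⟩
    + (a * A) +ℤ + X    ≡⟨ cong (_+ℤ + X) (pos-* a A) ⟩
    + a *ℤ + A +ℤ + X   ∎
    where open ≡-Reasoning
  A[b-a]≡X-C : + A *ℤ (b ⊖ a) ≡ + X -ℤ + C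
  A[b-a]≡X-C = begin
    + A *ℤ (b ⊖ a)
      ≡⟨ cong (+ A *ℤ_) (m-n≡m⊖n b a) ⟨
    + A *ℤ (+ b -ℤ + a)
      ≡⟨ solve 4 (λ A b a C → A :* (b :- a) := (C :+ b :* A) :- (C :+ a :* A)) refl (+ A) (+ b) (+ a) (+ C) ⟩
    (+ C +ℤ + b *ℤ + A) -ℤ (+ C +ℤ + a *ℤ + A)
      ≡⟨ cong (_-ℤ (+ C +ℤ + a *ℤ + A)) eqℤ ⟩
    (+ a *ℤ + A +ℤ + X) -ℤ (+ C +ℤ + a *ℤ + A)
      ≡⟨ solve 4 (λ a A X C → (a :* A :+ X) :- (C :+ a :* A) := X :- C) refl (+ a) (+ A) (+ X) (+ C) ⟩
    + X -ℤ + C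
      ∎
    where open ≡-Reasoning
  d∣A[b-a] : + d ∣ℤ + A *ℤ (b ⊖ a)
  d∣A[b-a] = subst (+ d ∣ℤ_) (sym A[b-a]≡X-C)
    (∣m∣n⇒∣m-n (∣ᵤ⇒∣ {i = + X} (∣n⇒∣m*n K (∣m⇒∣m*n Q d∣m))) (∣ᵤ⇒∣ {i = + C} d∣C))

seenCoefficient unseenCoefficient fullCoefficient : Effect → ℕ
seenCoefficient ifSeen = 1
seenCoefficient _      = 0
unseenCoefficient ifUnseen = 1
unseenCoefficient _        = 0
fullCoefficient decremented = 1
fullCoefficient ifSeen      = 1
fullCoefficient _           = 0

tally : ∀ {k} → (Effect → ℕ) → ℕ → Vec Σ₆ k → ℕ
tally c i []      = 0
tally c i (ξ ∷ W) = c (effect ξ i) + tally c i W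

tally≡count : ∀ {k} c i σ → (∀ ξ → c (effect ξ i) ≡ (σ == ξ)) →
              (W : Vec Σ₆ k) → tally c i W ≡ count σ W
tally≡count c i σ table []      = refl
tally≡count c i σ table (ξ ∷ W) = cong₂ _+_ (table ξ) (tally≡count c i σ table W)

unseen-effectAt : ∀ a i → unseenCoefficient (effectAt a i) ≡ 0
unseen-effectAt a i with compare i a
... | less    _ _ = refl
... | equal   _   = refl
... | greater _ _ = refl

unseen-only-Δ : ∀ ξ i → unseenCoefficient (effect ξ i) ≡ (sΔ == ξ)
unseen-only-Δ s0 i = refl
unseen-only-Δ sΔ i = refl
unseen-only-Δ s2 i = unseen-effectAt 2 i
unseen-only-Δ s3 i = unseen-effectAt 3 i
unseen-only-Δ s4 i = unseen-effectAt 4 i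
unseen-only-Δ s5 i = unseen-effectAt 5 i
unseen-only-Δ s6 i = unseen-effectAt 6 i

-- The coordinate on which the effect of M^σ_τ depends on τ (junk value 0 for s0 and sΔ).
coordinate : Σ₆ → ℕ
coordinate s2 = 2
coordinate s3 = 3
coordinate s4 = 4
coordinate s5 = 5
coordinate s6 = 6
coordinate _  = 0

seen-only-at-coordinate : ∀ σ → 2 ≤ coordinate σ →
                          ∀ ξ → seenCoefficient (effect ξ (coordinate σ)) ≡ (σ == ξ)
seen-only-at-coordinate s0 ()
seen-only-at-coordinate sΔ ()
seen-only-at-coordinate s2 _ = λ { s0 → refl ; sΔ → refl ; s2 → refl ; s3 → refl ; s4 → refl ; s5 → refl ; s6 → refl }
seen-only-at-coordinate s3 _ = λ { s0 → refl ; sΔ → refl ; s2 → refl ; s3 → refl ; s4 → refl ; s5 → refl ; s6 → refl }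
seen-only-at-coordinate s4 _ = λ { s0 → refl ; sΔ → refl ; s2 → refl ; s3 → refl ; s4 → refl ; s5 → refl ; s6 → refl }
seen-only-at-coordinate s5 _ = λ { s0 → refl ; sΔ → refl ; s2 → refl ; s3 → refl ; s4 → refl ; s5 → refl ; s6 → refl }
seen-only-at-coordinate s6 _ = λ { s0 → refl ; sΔ → refl ; s2 → refl ; s3 → refl ; s4 → refl ; s5 → refl ; s6 → refl }

decrement-first-coordinate : ∀ {m} ξ (τ : Fin m) → decrement ξ τ [] + (s0 == ξ) ≡ 1
decrement-first-coordinate s0 τ = refl
decrement-first-coordinate sΔ τ = refl
decrement-first-coordinate s2 τ = refl
decrement-first-coordinate s3 τ = refl
decrement-first-coordinate s4 τ = refl
decrement-first-coordinate s5 τ = refl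
decrement-first-coordinate s6 τ = refl


module _ {n : ℕ} where

  private
    F = Fin (suc n)
    open SingleCycle (dec-isSingleCycle {n})

  Mʳ-injective : ∀ {j} ξ τ {u v : Vec F j} → Mʳ ξ τ u ≡ Mʳ ξ τ v → u ≡ v
  Mʳ-injective ξ τ {[]}    {[]}      _  = refl
  Mʳ-injective ξ τ {t ∷ y} {t′ ∷ y′} eq with ∷-injective eq
  ... | t-eq , y-eq with Mʳ-injective ξ τ y-eq
  ... | refl = cong (_∷ y) (begin
    t                                               ≡⟨ iter-inverseˡ (decrement ξ τ y) t ⟨
    iter dec (n * d) (iter dec d t)                 ≡⟨ cong (iter dec (n * d)) t-eq ⟩
    iter dec (n * d) (iter dec d t′)                ≡⟨ iter-inverseˡ d t′ ⟩
    t′                                              ∎)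
    where
    open ≡-Reasoning
    d = decrement ξ τ y

  Mʳ-surjective : ∀ {j} ξ τ (v : Vec F j) → ∃ λ u → Mʳ ξ τ u ≡ v
  Mʳ-surjective ξ τ [] = [] , refl
  Mʳ-surjective ξ τ (t′ ∷ y′) with Mʳ-surjective ξ τ y′
  ... | y , refl =
    iter dec (n * decrement ξ τ y) t′ ∷ y , cong (_∷ Mʳ ξ τ y) (iter-inverseʳ (decrement ξ τ y) t′)

  allQ : ∀ j → List (Vec F j)
  allQ zero    = [ [] ]
  allQ (suc j) = cartesianProductWith _∷_ (allFin (suc n)) (allQ j)

  allQ-enumerates : ∀ j → Enumerates (allQ j)
  allQ-enumerates zero    = (All.[] AllPairs.∷ AllPairs.[]) , λ { [] → here refl }
  allQ-enumerates (suc j) =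
    Unique.cartesianProductWith⁺ _∷_ ∷-injective (Unique.allFin⁺ (suc n)) (proj₁ (allQ-enumerates j)) ,
    λ { (x ∷ y) → ∈-cartesianProductWith⁺ _∷_ (∈-allFin x) (proj₂ (allQ-enumerates j) y) }

  ΣQ : ∀ j → (Vec F j → ℕ) → ℕ
  ΣQ j h = sum (map h (allQ j))

  ΣQ-cong : ∀ j {h h′ : Vec F j → ℕ} → (∀ y → h y ≡ h′ y) → ΣQ j h ≡ ΣQ j h′
  ΣQ-cong j h≗h′ = cong sum (map-cong h≗h′ (allQ j))

  ΣQ-∷ : ∀ j (h : Vec F (suc j) → ℕ) → ΣQ (suc j) h ≡ sum (tabulate (λ x → ΣQ j (λ y → h (x ∷ y))))
  ΣQ-∷ j h = trans (sum-cartesianProductWith _∷_ h (allFin (suc n)) (allQ j))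
                   (cong sum (map-tabulate id (λ x → ΣQ j (λ y → h (x ∷ y)))))

  ΣQ-Mʳ : ∀ j ξ τ (h : Vec F j → ℕ) → ΣQ j (h ∘ Mʳ ξ τ) ≡ ΣQ j h
  ΣQ-Mʳ j ξ τ h = trans (cong sum (map-∘ (allQ j)))
    (sum-map-enumerations Mʳ-allQ-enumerates (allQ-enumerates j) h)
    where
    Mʳ-allQ-enumerates = map-enumerates (Mʳ ξ τ) (Mʳ-injective ξ τ) (Mʳ-surjective ξ τ) (allQ-enumerates j)

  ΣQ-zero : ∀ j → ΣQ j (λ _ → 0) ≡ 0
  ΣQ-zero j = sum-map-0 (allQ j)

  ΣQ-one : ∀ j → ΣQ j (λ _ → 1) ≡ suc n ^ j
  ΣQ-one zero    = refl
  ΣQ-one (suc j) = trans (ΣQ-∷ j (λ _ → 1))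
    (trans (cong sum (tabulate-cong {n = suc n} {f = λ _ → ΣQ j (λ _ → 1)} (λ _ → ΣQ-one j)))
           (sum-tabulate-const (suc n) (suc n ^ j)))

  ΣQ-unseen : ∀ j τ → ΣQ j (λ y → indicator (not (seen τ y))) ≡ n ^ j
  ΣQ-unseen zero    τ = refl
  ΣQ-unseen (suc j) τ = trans (ΣQ-∷ j (λ y → indicator (not (seen τ y))))
    (trans (cong sum (tabulate-cong (λ x → unseen-after (does (x Fin.≟ τ)))))
           (sum-tabulate-except n τ (n ^ j)))
    where
    unseen-after : ∀ b → ΣQ j (λ y → indicator (not (seen τ y ∨ b))) ≡ (if b then 0 else n ^ j)
    unseen-after true  =
      trans (ΣQ-cong j (λ y → cong (indicator ∘ not) (∨-zeroʳ (seen τ y)))) (ΣQ-zero j)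
    unseen-after false =
      trans (ΣQ-cong j (λ y → cong (indicator ∘ not) (∨-identityʳ (seen τ y)))) (ΣQ-unseen j τ)

  ΣQ-seen : ∀ j τ → ΣQ j (indicator ∘ seen τ) + n ^ j ≡ suc n ^ j
  ΣQ-seen j τ = begin
    ΣQ j (indicator ∘ seen τ) + n ^ j
      ≡⟨ cong (_+_ (ΣQ j (indicator ∘ seen τ))) (ΣQ-unseen j τ) ⟨
    ΣQ j (indicator ∘ seen τ) + ΣQ j (λ y → indicator (not (seen τ y)))
      ≡⟨ sum-map-+ (indicator ∘ seen τ) (λ y → indicator (not (seen τ y))) (allQ j) ⟨
    ΣQ j (λ y → indicator (seen τ y) + indicator (not (seen τ y)))
      ≡⟨ ΣQ-cong j (λ y → indicator+indicator[not] (seen τ y)) ⟩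
    ΣQ j (λ _ → 1)
      ≡⟨ ΣQ-one j ⟩
    suc n ^ j ∎
    where
    open ≡-Reasoning
    indicator+indicator[not] : ∀ b → indicator b + indicator (not b) ≡ 1
    indicator+indicator[not] true  = refl
    indicator+indicator[not] false = refl

  ΣQ-amount : ∀ j e (τ : F) → ΣQ j (amount e ∘ seen τ) + seenCoefficient e * n ^ j
                               ≡ unseenCoefficient e * n ^ j + fullCoefficient e * suc n ^ j
  ΣQ-amount j untouched   τ = trans (+-identityʳ _) (ΣQ-zero j)
  ΣQ-amount j decremented τ = trans (+-identityʳ _) (trans (ΣQ-one j) (sym (+-identityʳ _)))
  ΣQ-amount j ifUnseen    τ =
    trans (+-identityʳ _) (trans (ΣQ-unseen j τ) (sym (trans (+-identityʳ _) (+-identityʳ _))))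
  ΣQ-amount j ifSeen      τ =
    trans (cong (_+_ (ΣQ j (indicator ∘ seen τ))) (+-identityʳ _)) (trans (ΣQ-seen j τ) (sym (+-identityʳ _)))

  -- That is, ΣQ j (weight W τs) = (#ifUnseen − #ifSeen) (m−1)^j + (#decremented + #ifSeen) m^j,
  -- with the #ifSeen term moved to the left to avoid truncated subtraction.
  weight-equation : ∀ j {k} (W : Vec Σ₆ k) (τs : Vec F k) →
    ΣQ j (weight W τs) + tally seenCoefficient (suc j) W * n ^ j
      ≡ tally unseenCoefficient (suc j) W * n ^ j + tally fullCoefficient (suc j) W * suc n ^ j
  weight-equation j []       []       = trans (+-identityʳ _) (ΣQ-zero j)
  weight-equation j (ξ ∷ W) (τ ∷ τs) = begin
    ΣQ j (λ y → weight W τs (Mʳ ξ τ y) + decrement ξ τ y) + (s + S) * A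
      ≡⟨ cong (_+ (s + S) * A) (sum-map-+ (weight W τs ∘ Mʳ ξ τ) (decrement ξ τ) (allQ j)) ⟩
    ΣQ j (weight W τs ∘ Mʳ ξ τ) + X + (s + S) * A
      ≡⟨ cong (λ c → c + X + (s + S) * A) (ΣQ-Mʳ j ξ τ (weight W τs)) ⟩
    C + X + (s + S) * A
      ≡⟨ solve 5 (λ C X s S A → C :+ X :+ (s :+ S) :* A := (X :+ s :* A) :+ (C :+ S :* A)) refl C X s S A ⟩
    (X + s * A) + (C + S * A)
      ≡⟨ cong₂ _+_ (ΣQ-amount j (effect ξ (suc j)) τ) (weight-equation j W τs) ⟩
    (u * A + f * P) + (U * A + Fu * P)
      ≡⟨ solve 6 (λ u f U Fu A P → (u :* A :+ f :* P) :+ (U :* A :+ Fu :* P) := (u :+ U) :* A :+ (f :+ Fu) :* P)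
                 refl u f U Fu A P ⟩
    (u + U) * A + (f + Fu) * P ∎
    where
    open ≡-Reasoning
    open +-*-Solver
    A = n ^ j
    P = suc n ^ j
    C = ΣQ j (weight W τs)
    X = ΣQ j (decrement ξ τ)
    s = seenCoefficient (effect ξ (suc j))
    S = tally seenCoefficient (suc j) W
    u = unseenCoefficient (effect ξ (suc j))
    U = tally unseenCoefficient (suc j) W
    f = fullCoefficient (effect ξ (suc j))
    Fu = tally fullCoefficient (suc j) W

  weight-first-coordinate : ∀ {k} (W : Vec Σ₆ k) (τs : Vec F k) → weight W τs [] + count s0 W ≡ k
  weight-first-coordinate []      []       = refl
  weight-first-coordinate {suc k} (ξ ∷ W) (τ ∷ τs) = begin
    weight W τs [] + decrement ξ τ [] + ((s0 == ξ) + count s0 W)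
      ≡⟨ solve 4 (λ w d e c → w :+ d :+ (e :+ c) := (d :+ e) :+ (w :+ c))
                 refl (weight W τs []) (decrement ξ τ []) (s0 == ξ) (count s0 W) ⟩
    (decrement ξ τ [] + (s0 == ξ)) + (weight W τs [] + count s0 W)
      ≡⟨ cong₂ _+_ (decrement-first-coordinate ξ τ) (weight-first-coordinate W τs) ⟩
    suc k ∎
    where
    open ≡-Reasoning
    open +-*-Solver

  first-level-coprime : (W : Vec Σ₆ (suc n)) (τs : Vec F (suc n)) →
                        gcd (+ count s0 W) (+ suc n) ≡ + 1 → Coprime (ΣQ 0 (weight W τs)) (suc n)
  first-level-coprime W τs gcd≡1 {d} (d∣C , d∣m) = gcd≡1⇒coprime (cong ∣_∣ gcd≡1)
    (∣m+n∣m⇒∣n (subst (d ∣_) (sym (weight-first-coordinate W τs)) d∣m) (subst (d ∣_) (+-identityʳ _) d∣C) ,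
     d∣m)

  later-level-coprime : ∀ {k} (W : Vec Σ₆ k) (τs : Vec F k) σ j →
    (∀ ξ → seenCoefficient (effect ξ (suc (suc j))) ≡ (σ == ξ)) →
    gcd (count σ W ⊖ count sΔ W) (+ suc n) ≡ + 1 → Coprime (ΣQ (suc j) (weight W τs)) (suc n)
  later-level-coprime W τs σ j seen-table gcd≡1 =
    coprime-of-combination {a = count sΔ W} {b = count σ W} {K = K}
      (gcd≡1⇒coprime (cong ∣_∣ gcd≡1)) (coprime-^ (suc j) (pred-coprime n)) (begin
      ΣQ (suc j) (weight W τs) + count σ W * A
        ≡⟨ cong (λ c → ΣQ (suc j) (weight W τs) + c * A) (tally≡count seenCoefficient _ σ seen-table W) ⟨
      ΣQ (suc j) (weight W τs) + tally seenCoefficient (suc (suc j)) W * A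
        ≡⟨ weight-equation (suc j) W τs ⟩
      tally unseenCoefficient (suc (suc j)) W * A + K * suc n ^ suc j
        ≡⟨ cong (λ c → c * A + K * suc n ^ suc j)
                (tally≡count unseenCoefficient _ sΔ (λ ξ → unseen-only-Δ ξ _) W) ⟩
      count sΔ W * A + K * suc n ^ suc j ∎)
    where
    open ≡-Reasoning
    A = n ^ suc j
    K = tally fullCoefficient (suc (suc j)) W

  Rʳ-isSingleCycle : ∀ {k} (W : Vec Σ₆ k) (τs : Vec F k) j →
                     (∀ i → i < j → Coprime (ΣQ i (weight W τs)) (suc n)) →
                     IsSingleCycle (Rʳ {j = j} W τs) (suc n ^ j)
  Rʳ-isSingleCycle W τs zero    _       = Vec0-isSingleCycle (Rʳ W τs)
  Rʳ-isSingleCycle W τs (suc j) coprime =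
    IsSingleCycle-reflect split split-injective split-Rʳ (skew-isSingleCycle cocycle-coprime)
    where
    open SkewProduct dec-isSingleCycle
                     (Rʳ-isSingleCycle W τs j (λ i i<j → coprime i (m<n⇒m<1+n i<j))) (weight W τs)
    split : Vec F (suc j) → F × Vec F j
    split (t ∷ y) = t , y
    split-injective : ∀ {x x′} → split x ≡ split x′ → x ≡ x′
    split-injective {_ ∷ _} {_ ∷ _} refl = refl
    split-Rʳ : ∀ x → split (Rʳ W τs x) ≡ skew (split x)
    split-Rʳ (t ∷ y) = cong split (Rʳ-∷ W τs t y)
    cocycle-coprime : ∀ y → Coprime (cocycle (suc n ^ j) y) (suc n)
    cocycle-coprime y =
      subst (λ c → Coprime c (suc n)) (sym (cocycle-period≡sum (allQ-enumerates j) y)) (coprime j ≤-refl)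

lemma3p3 : (m : ℕ) → 2 ≤ m → (W : Vec Σ₆ m) →
    gcd (+ count s0 W) (+ m) ≡ + 1 →
    gcd (count s2 W ⊖ count sΔ W) (+ m) ≡ + 1 →
    gcd (count s3 W ⊖ count sΔ W) (+ m) ≡ + 1 →
    gcd (count s4 W ⊖ count sΔ W) (+ m) ≡ + 1 →
    gcd (count s5 W ⊖ count sΔ W) (+ m) ≡ + 1 →
    gcd (count s6 W ⊖ count sΔ W) (+ m) ≡ + 1 →
    (τs : Vec (Fin m) m) →
    IsSingleCycle (R W τs) (m ^ 6)
lemma3p3 (suc n) _ W h0 h2 h3 h4 h5 h6 τs =
  IsSingleCycle-reflect rev6 rev6-injective (R-reversed W τs) (Rʳ-isSingleCycle W τs 6 level-coprime)
  where
  level-coprime : ∀ i → i < 6 → Coprime (ΣQ i (weight W τs)) (suc n)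
  level-coprime 0 _ = first-level-coprime W τs h0
  level-coprime 1 _ = later-level-coprime W τs s2 0 (seen-only-at-coordinate s2 (s≤s (s≤s z≤n))) h2
  level-coprime 2 _ = later-level-coprime W τs s3 1 (seen-only-at-coordinate s3 (s≤s (s≤s z≤n))) h3
  level-coprime 3 _ = later-level-coprime W τs s4 2 (seen-only-at-coordinate s4 (s≤s (s≤s z≤n))) h4
  level-coprime 4 _ = later-level-coprime W τs s5 3 (seen-only-at-coordinate s5 (s≤s (s≤s z≤n))) h5
  level-coprime 5 _ = later-level-coprime W τs s6 4 (seen-only-at-coordinate s6 (s≤s (s≤s z≤n))) h6
  level-coprime (suc (suc (suc (suc (suc (suc _)))))) (s≤s (s≤s (s≤s (s≤s (s≤s (s≤s ()))))))
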